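{- Let $H$ be an $n\times n$ Hadamard matrix with $n\equiv 4\pmod 8$ that has a Hall set, let $G_H$ be its Hadamard graph, and let $H'$ be a matrix obtained from $H$ by switching a Hall set. Then there exists a switching partition $\{C_1,\dots,C_t,D\}$ of the vertex set of $G_H$ (satisfying the conditions of GM-switching) such that the graph obtained from $G_H$ by GM-switching with respect to this partition is isomorphic to the Hadamard graph $G_{H'}$; that is, switching a Hall set on $H$ is equivalent to GM-switching on $G_H$.
   Context: A Hadamard matrix is a square $n\times n$ matrix $H$ with entries in $\{1,-1\}$ with $HH^T=nI$. Two Hadamard matrices are equivalent if one is obtained from the other by permuting rows and/or columns and negating rows and/or columns. Let $n\equiv 4\pmod 8$ and $m=n/4-1$. A Hadamard matrix $H$ of order $n$ has a Hall set precisely when it is equivalent to a matrix of the block form $$\begin{pmatrix} H_4 & F_1 & F_2 & F_3 & F_4\\ G_1 & A_{11}&A_{12}&A_{13}&A_{14}\\ G_2&A_{21}&A_{22}&A_{23}&A_{24}\\ G_3&A_{31}&A_{32}&A_{33}&A_{34}\\ G_4&A_{41}&A_{42}&A_{43}&A_{44}\end{pmatrix},$$ where $H_4$ is the $4\times4$ matrix with $1$ on the diagonal and $-1$ off the diagonal; $F_1,\dots,F_4$ are $4\times m$ matrices with constant rows, the rows (top to bottom) being all $1,1,1,1$ for $F_1$; all $1,-1,-1,1$ for $F_2$; all $1,-1,1,-1$ for $F_3$; all $-1,-1,1,1$ for $F_4$; $G_1=F_1^T$ and $G_j=-F_j^T$ for $j=2,3,4$; and each $A_{ij}$ is an $m\times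 m$ $\{1,-1\}$-matrix whose row and column sums all equal $2$ if $i=j$ and $0$ if $i\ne j$. (Here the first four rows form the Hall set rows and the first four columns the Hall columns.) Switching a Hall set means: bring $H$ to this form and negate $F_i$ and the corresponding $G_i$ for one $i\in\{1,2,3,4\}$; the result is again a Hadamard matrix. Hadamard graph: for an $n\times n$ $\{1,-1\}$-matrix $H$, $G_H$ has vertices $v_1,\dots,v_n,v'_1,\dots,v'_n,w_1,\dots,w_n,w'_1,\dots,w'_n$; if $h_{ij}=1$ it has edges $v_iw_j$, $v'_iw'_j$, and if $h_{ij}=-1$ edges $v_iw'_j$, $v'_iw_j$; there is a loop at every $v_i$ and $v'_i$ (a vertex with a loop counts as its own neighbour). Equivalent Hadamard matrices have isomorphic Hadamard graphs. GM-switching: a partition $\{C_1,\dots,C_t,D\}$ of the vertex set is a switching partition if (i) for all $i,j$, every vertex of $C_i$ has the same number of neighbours in $C_j$, and (ii) every vertex of $D$ has $0$, $\tfrac12|C_i|$ or $|C_i|$ neighbours in each $C_i$. GM-switching means: for every $i$ and every $v\in D$ with exactly $\tfrac12|C_i|$ neighbours in $C_i$, replace the adjacencies between $v$ and $C_i$ by their complement. -}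

module Defs where

open import Data.Bool using (Bool; true; false; if_then_else_; not; _∧_; _∨_; T)
open import Data.Nat using (ℕ; zero; suc; _≤ᵇ_; _<ᵇ_; _∸_; _/_) renaming (_+_ to _+ℕ_; _*_ to _*ℕ_)
import Data.Nat as ℕ
open import Data.Integer using (ℤ; +_; -_; _+_; _*_)
import Data.Integer as ℤ
open import Data.Fin using (Fin; zero; suc; toℕ)
import Data.Fin as Fin
open import Data.Maybe using (Maybe; just; nothing)
open import Data.Product using (Σ; ∃; _×_; _,_)
open import Data.Sum using (_⊎_)
open import Relation.Binary.PropositionalEquality using (_≡_)
open import Relation.Nullary.Decidable using (⌊_⌋)
open import Function.Bundles using (_↔_; Inverse)

sumℤ : ∀ {n} → (Fin n → ℤ) → ℤ
sumℤ {zero}  f = + 0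
sumℤ {suc n} f = f zero + sumℤ (λ k → f (suc k))

countFin : ∀ {n} → (Fin n → Bool) → ℕ
countFin {zero}  p = 0
countFin {suc n} p = (if p zero then 1 else 0) +ℕ countFin (λ k → p (suc k))

Matrix : ℕ → Set
Matrix n = Fin n → Fin n → ℤ

_==ᶠ_ : ∀ {n} → Fin n → Fin n → Bool
i ==ᶠ j = ⌊ i Fin.≟ j ⌋

IsHadamard : ∀ {n} → Matrix n → Set
IsHadamard {n} H =
  (∀ i j → H i j ≡ + 1 ⊎ H i j ≡ - (+ 1)) ×
  (∀ i j → sumℤ (λ k → H i k * H j k) ≡ (if i ==ᶠ j then + n else + 0))

sign : Bool → ℤ
sign true  = + 1
sign false = - (+ 1)

Equivalent : ∀ {n} → Matrix n → Matrix n → Set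
Equivalent {n} H M =
  Σ (Fin n ↔ Fin n) λ σ → Σ (Fin n ↔ Fin n) λ τ →
  Σ (Fin n → Bool) λ r → Σ (Fin n → Bool) λ c →
    ∀ k l → M k l ≡ (sign (r k) * sign (c l)) * H (Inverse.to σ k) (Inverse.to τ l)

-- The Hall block form.  Indices 0..3 are the Hall rows/columns; block
-- j ∈ Fin 4 (j = 0 ↦ F₁/G₁/A₁·, …) consists of indices
-- 4 + j*m ≤ t < 4 + (j+1)*m, where m = n/4 - 1.

hallM : ℕ → ℕ
hallM n = (n / 4) ∸ 1

isHallᵇ : ℕ → Bool
isHallᵇ t = t <ᵇ 4

inBlockᵇ : ℕ → Fin 4 → ℕ → Bool
inBlockᵇ m j t = ((4 +ℕ toℕ j *ℕ m) ≤ᵇ t) ∧ (t <ᵇ (4 +ℕ suc (toℕ j) *ℕ m))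

h4 : Fin 4 → Fin 4 → ℤ
h4 a b = if a ==ᶠ b then + 1 else - (+ 1)

-- fRow j a : the constant value of row a of F_{j+1}
fRow : Fin 4 → Fin 4 → ℤ
fRow zero a = + 1
fRow (suc zero) zero = + 1
fRow (suc zero) (suc zero) = - (+ 1)
fRow (suc zero) (suc (suc zero)) = - (+ 1)
fRow (suc zero) (suc (suc (suc zero))) = + 1
fRow (suc (suc zero)) zero = + 1
fRow (suc (suc zero)) (suc zero) = - (+ 1)
fRow (suc (suc zero)) (suc (suc zero)) = + 1
fRow (suc (suc zero)) (suc (suc (suc zero))) = - (+ 1)
fRow (suc (suc (suc zero))) zero = - (+ 1)
fRow (suc (suc (suc zero))) (suc zero) = - (+ 1)
fRow (suc (suc (suc zero))) (suc (suc zero)) = + 1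
fRow (suc (suc (suc zero))) (suc (suc (suc zero))) = + 1

-- G₁ = F₁ᵀ, G_j = -F_jᵀ for j = 2,3,4
gSign : Fin 4 → ℤ
gSign zero = + 1
gSign (suc _) = - (+ 1)

-- required row/column sum of A_{ij}
blockSum : Fin 4 → Fin 4 → ℤ
blockSum i j = if i ==ᶠ j then + 2 else + 0

HallForm : ∀ {n} → Matrix n → Set
HallForm {n} M =
  (∀ (a b : Fin 4) (k l : Fin n) → toℕ k ≡ toℕ a → toℕ l ≡ toℕ b → M k l ≡ h4 a b) ×
  (∀ (a j : Fin 4) (k l : Fin n) → toℕ k ≡ toℕ a → T (inBlockᵇ m j (toℕ l)) → M k l ≡ fRow j a) ×
  (∀ (a j : Fin 4) (k l : Fin n) → T (inBlockᵇ m j (toℕ k)) → toℕ l ≡ toℕ a → M k l ≡ gSign j * fRow j a) ×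
  (∀ (i j : Fin 4) (k : Fin n) → T (inBlockᵇ m i (toℕ k)) →
     sumℤ (λ l → if inBlockᵇ m j (toℕ l) then M k l else + 0) ≡ blockSum i j) ×
  (∀ (i j : Fin 4) (l : Fin n) → T (inBlockᵇ m j (toℕ l)) →
     sumℤ (λ k → if inBlockᵇ m i (toℕ k) then M k l else + 0) ≡ blockSum i j)
  where m = hallM n

HasHallSet : ∀ {n} → Matrix n → Set
HasHallSet {n} H = Σ (Matrix n) λ M → Equivalent H M × HallForm M

-- negate F_{i+1} and G_{i+1}
switchHall : ∀ {n} → Fin 4 → Matrix n → Matrix n
switchHall {n} i M k l =
  if (isHallᵇ (toℕ k) ∧ inBlockᵇ (hallM n) i (toℕ l)) ∨ (inBlockᵇ (hallM n) i (toℕ k) ∧ isHallᵇ (toℕ l))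
  then - M k l else M k l

HallSwitched : ∀ {n} → Matrix n → Matrix n → Set
HallSwitched {n} H H' =
  Σ (Matrix n) λ M → Equivalent H M × HallForm M ×
    Σ (Fin 4) λ i → ∀ k l → H' k l ≡ switchHall i M k l

-- Graphs on a vertex set of the form Layer × Fin n, given by a symmetric
-- Bool-valued adjacency (loops allowed: a looped vertex is its own neighbour).

data Layer : Set where
  V V' W W' : Layer

Vertex : ℕ → Set
Vertex n = Layer × Fin n

Graph : ℕ → Set
Graph n = Vertex n → Vertex n → Bool

countV : ∀ {n} → (Vertex n → Bool) → ℕ
countV p = countFin (λ i → p (V , i)) +ℕ countFin (λ i → p (V' , i))
        +ℕ countFin (λ i → p (W , i)) +ℕ countFin (λ i → p (W' , i))

isOne isMinusOne : ℤ → Bool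
isOne x = ⌊ x ℤ.≟ + 1 ⌋
isMinusOne x = ⌊ x ℤ.≟ - (+ 1) ⌋

hadamardGraph : ∀ {n} → Matrix n → Graph n
hadamardGraph H (V  , i) (V  , j) = i ==ᶠ j
hadamardGraph H (V' , i) (V' , j) = i ==ᶠ j
hadamardGraph H (V  , i) (W  , j) = isOne (H i j)
hadamardGraph H (V' , i) (W' , j) = isOne (H i j)
hadamardGraph H (V  , i) (W' , j) = isMinusOne (H i j)
hadamardGraph H (V' , i) (W  , j) = isMinusOne (H i j)
hadamardGraph H (W  , j) (V  , i) = isOne (H i j)
hadamardGraph H (W' , j) (V' , i) = isOne (H i j)
hadamardGraph H (W' , j) (V  , i) = isMinusOne (H i j)
hadamardGraph H (W  , j) (V' , i) = isMinusOne (H i j)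
hadamardGraph H _ _ = false

-- GM-switching.  A partition {C_1,…,C_t,D} is given by
-- part : Vertex n → Maybe (Fin t), with C_i = part⁻¹(just i), D = part⁻¹(nothing).

inPart : ∀ {n t} → (Vertex n → Maybe (Fin t)) → Fin t → Vertex n → Bool
inPart part i x with part x
... | just j  = j ==ᶠ i
... | nothing = false

partSize : ∀ {n t} → (Vertex n → Maybe (Fin t)) → Fin t → ℕ
partSize part i = countV (inPart part i)

nbrsIn : ∀ {n t} → Graph n → (Vertex n → Maybe (Fin t)) → Vertex n → Fin t → ℕ
nbrsIn G part x i = countV (λ y → G x y ∧ inPart part i y)

IsSwitchingPartition : ∀ {n t} → Graph n → (Vertex n → Maybe (Fin t)) → Set
IsSwitchingPartition {n} {t} G part =
  (∀ (i : Fin t) → ∃ λ (x : Vertex n) → part x ≡ just i) ×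
  (∀ (i j : Fin t) (x y : Vertex n) → part x ≡ just i → part y ≡ just i →
     nbrsIn G part x j ≡ nbrsIn G part y j) ×
  -- (ii)  (½|C_i| neighbours written as 2·#nbrs = |C_i|)
  (∀ (x : Vertex n) → part x ≡ nothing → ∀ (i : Fin t) →
     nbrsIn G part x i ≡ 0 ⊎ 2 *ℕ nbrsIn G part x i ≡ partSize part i ⊎
     nbrsIn G part x i ≡ partSize part i)

halfᵇ : ∀ {n t} → Graph n → (Vertex n → Maybe (Fin t)) → Vertex n → Fin t → Bool
halfᵇ G part x i = ⌊ (2 *ℕ nbrsIn G part x i) ℕ.≟ partSize part i ⌋

gmSwitch : ∀ {n t} → Graph n → (Vertex n → Maybe (Fin t)) → Graph n
gmSwitch G part x y with part x | part y
... | nothing | just i  = if halfᵇ G part x i then not (G x y) else G x y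
... | just i  | nothing = if halfᵇ G part y i then not (G x y) else G x y
... | _       | _       = G x y

Isomorphic : ∀ {n} → Graph n → Graph n → Set
Isomorphic {n} G G' =
  Σ (Vertex n ↔ Vertex n) λ φ → ∀ x y → G x y ≡ G' (Inverse.to φ x) (Inverse.to φ y)

-- Equivalent Hadamard matrices have isomorphic Hadamard graphs, and GM-switching commutes with
-- isomorphisms, so it suffices to treat a matrix M in Hall form in which F_i and G_i are negated.
-- The 16 vertices v_a, v'_a, w_a, w'_a on the four Hall lines a split into four classes of four
-- according to the signs of F_i and G_i, and all other vertices form D. Every other line lies in
-- exactly one of the four blocks (this is where n ≡ 4 (mod 8) enters), so a vertex of D sees 0, 2
-- or 4 vertices of each class, depending only on its block; toggling its adjacency to the
-- half-classes and then exchanging v_a ↔ v'_a and w_a ↔ w'_a on the Hall lines gives exactly the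
-- Hadamard graph of the switched matrix.
module Submission where

open import Defs
import Data.Bool as Bool
open import Data.Bool using (Bool; true; false; if_then_else_; not; _∧_; _∨_; T)
open import Data.Bool.Properties using (∧-zeroʳ; ∧-identityʳ; ∨-identityʳ; not-involutive; T-∧; T-≡)
open import Data.Fin as Fin using (Fin; zero; suc; toℕ; _↑ˡ_; _↑ʳ_; combine; remQuot)
open import Data.Fin.Patterns using (0F; 1F; 2F; 3F)
import Data.Fin.Properties as Fin
open import Data.Fin.Properties using (all?)
open import Data.Integer as ℤ using (ℤ)
import Data.Integer.Properties as ℤ
open import Data.Maybe using (Maybe; just; nothing)
open import Data.Maybe.Properties using (just-injective)
open import Data.Nat using (ℕ; zero; suc; _+_; _*_; _∸_; _/_; _%_; _≤_; _<_)
import Data.Nat as ℕ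
import Data.Nat.Properties as ℕ
open import Data.Nat.DivMod using (m≡m%n+[m/n]*n; m*n/n≡m)
open import Data.Nat.Tactic.RingSolver using (solve-∀)
open import Data.Product using (Σ; _×_; _,_; proj₁; proj₂)
open import Data.Sum using (_⊎_)
open import Function using (_∘_)
open import Function.Bundles using (_↔_; Inverse; Injection; Equivalence; mk↔ₛ′)
open import Function.Properties.Inverse using (↔-refl; ↔-sym; ↔-trans; ↔⇒↣)
open import Relation.Binary.PropositionalEquality
open import Relation.Nullary using (Dec; yes; no; ¬_; contradiction)
open import Relation.Nullary.Decidable using (⌊_⌋; from-yes; map′; _⊎-dec_; _×-dec_; _→-dec_)
open import Algebra.Properties.CommutativeMonoid.Sum ℕ.+-0-commutativeMonoid using (sum; sum-cong-≗; sum-permute)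

open Inverse using (to; from; strictlyInverseˡ; strictlyInverseʳ)

indicator : Bool → ℕ
indicator b = if b then 1 else 0

countFin≡sum : ∀ {n} (p : Fin n → Bool) → countFin p ≡ sum (indicator ∘ p)
countFin≡sum {zero}  p = refl
countFin≡sum {suc n} p = cong (indicator (p zero) +_) (countFin≡sum (p ∘ suc))

countFin-cong : ∀ {n} {p q : Fin n → Bool} → (∀ k → p k ≡ q k) → countFin p ≡ countFin q
countFin-cong {p = p} {q} p≗q = trans (countFin≡sum p) (trans (sum-cong-≗ (cong indicator ∘ p≗q)) (sym (countFin≡sum q)))

countFin-false : ∀ {n} (p : Fin n → Bool) → (∀ k → p k ≡ false) → countFin p ≡ 0
countFin-false {zero}  p p≡false = refl
countFin-false {suc n} p p≡false rewrite p≡false zero = countFin-false (p ∘ suc) (p≡false ∘ suc)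

sum-splitAt : ∀ m {k} (f : Fin (m + k) → ℕ) → sum f ≡ sum (f ∘ (_↑ˡ k)) + sum (f ∘ (m ↑ʳ_))
sum-splitAt zero    f = refl
sum-splitAt (suc m) f = trans (cong (f zero +_) (sum-splitAt m (f ∘ suc))) (sym (ℕ.+-assoc (f zero) _ _))

sum-combine : ∀ m {n} (f : Fin (m * n) → ℕ) → sum f ≡ sum (λ i → sum (λ j → f (combine {m} {n} i j)))
sum-combine zero        f = refl
sum-combine (suc m) {n} f =
  trans (sum-splitAt n f) (cong (sum (f ∘ combine {suc m} zero) +_) (sum-combine m (f ∘ (n ↑ʳ_))))

layerIndex : Layer → Fin 4
layerIndex V  = 0F
layerIndex V' = 1F
layerIndex W  = 2F
layerIndex W' = 3F

indexLayer : Fin 4 → Layer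
indexLayer 0F = V
indexLayer 1F = V'
indexLayer 2F = W
indexLayer 3F = W'

layerIndex-indexLayer : ∀ i → layerIndex (indexLayer i) ≡ i
layerIndex-indexLayer 0F = refl
layerIndex-indexLayer 1F = refl
layerIndex-indexLayer 2F = refl
layerIndex-indexLayer 3F = refl

indexLayer-layerIndex : ∀ L → indexLayer (layerIndex L) ≡ L
indexLayer-layerIndex V  = refl
indexLayer-layerIndex V' = refl
indexLayer-layerIndex W  = refl
indexLayer-layerIndex W' = refl

vertex↔Fin : ∀ {n} → Vertex n ↔ Fin (4 * n)
vertex↔Fin {n} = mk↔ₛ′ encode decode encode∘decode decode∘encode
  where
  encode : Vertex n → Fin (4 * n)
  encode (L , k) = combine {4} {n} (layerIndex L) k
  decode : Fin (4 * n) → Vertex n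
  decode t = indexLayer (proj₁ (remQuot {4} n t)) , proj₂ (remQuot {4} n t)
  encode∘decode : ∀ t → encode (decode t) ≡ t
  encode∘decode t = trans (cong (λ i → combine {4} i (proj₂ (remQuot {4} n t))) (layerIndex-indexLayer (proj₁ (remQuot {4} n t))))
                          (Fin.combine-remQuot {4} n t)
  decode∘encode : ∀ x → decode (encode x) ≡ x
  decode∘encode (L , k) = trans (cong (λ (i , k) → indexLayer i , k) (Fin.remQuot-combine (layerIndex L) k))
                                (cong (_, k) (indexLayer-layerIndex L))

countV≡sum : ∀ {n} (q : Vertex n → Bool) → countV q ≡ sum (indicator ∘ q ∘ from vertex↔Fin)
countV≡sum {n} q = begin
  count V + count V' + count W + count W'
    ≡⟨ reassociate (count V) (count V') (count W) (count W') ⟩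
  count V + (count V' + (count W + (count W' + 0)))
    ≡⟨ cong₂ _+_ (count≡sum V) (cong₂ _+_ (count≡sum V') (cong₂ _+_ (count≡sum W) (cong (_+ 0) (count≡sum W')))) ⟩
  sumLayer V + (sumLayer V' + (sumLayer W + (sumLayer W' + 0)))
    ≡⟨⟩
  sum (λ i → sum (λ k → indicator (q (decode (combine {4} {n} i k)))))
    ≡⟨ sum-combine 4 {n} (indicator ∘ q ∘ decode) ⟨
  sum (indicator ∘ q ∘ decode) ∎
  where
  open ≡-Reasoning
  decode : Fin (4 * n) → Vertex n
  decode = from vertex↔Fin
  count : Layer → ℕ
  count L = countFin (q ∘ (L ,_))
  sumLayer : Layer → ℕ
  sumLayer L = sum (λ k → indicator (q (decode (combine {4} {n} (layerIndex L) k))))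
  count≡sum : ∀ L → count L ≡ sumLayer L
  count≡sum L = trans (countFin≡sum (q ∘ (L ,_)))
    (sum-cong-≗ (λ k → cong (indicator ∘ q) (sym (strictlyInverseʳ vertex↔Fin (L , k)))))
  reassociate : ∀ a b c d → a + b + c + d ≡ a + (b + (c + (d + 0)))
  reassociate = solve-∀

countV-permute : ∀ {n} (φ : Vertex n ↔ Vertex n) (q : Vertex n → Bool) → countV (q ∘ to φ) ≡ countV q
countV-permute {n} φ q = begin
  countV (q ∘ to φ)                      ≡⟨ countV≡sum (q ∘ to φ) ⟩
  sum (indicator ∘ q ∘ to φ ∘ decode)    ≡⟨ sum-cong-≗ (cong (indicator ∘ q) ∘ sym ∘ strictlyInverseʳ vertex↔Fin ∘ to φ ∘ decode) ⟩
  sum (indicator ∘ q ∘ decode ∘ to π)    ≡⟨ sum-permute (indicator ∘ q ∘ decode) π ⟨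
  sum (indicator ∘ q ∘ decode)           ≡⟨ countV≡sum q ⟨
  countV q                               ∎
  where
  open ≡-Reasoning
  decode : Fin (4 * n) → Vertex n
  decode = from vertex↔Fin
  π : Fin (4 * n) ↔ Fin (4 * n)
  π = ↔-trans (↔-sym vertex↔Fin) (↔-trans φ vertex↔Fin)

countV-cong : ∀ {n} {p q : Vertex n → Bool} → (∀ x → p x ≡ q x) → countV p ≡ countV q
countV-cong p≗q = cong₂ _+_ (cong₂ _+_ (cong₂ _+_ (countFin-cong (p≗q ∘ (V ,_))) (countFin-cong (p≗q ∘ (V' ,_))))
                                       (countFin-cong (p≗q ∘ (W ,_))))
                            (countFin-cong (p≗q ∘ (W' ,_)))

-- Isomorphism invariance of GM-switching

module _ {n : ℕ} where

  ≗⇒Isomorphic : {G G′ : Graph n} → (∀ x y → G x y ≡ G′ x y) → Isomorphic G G′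
  ≗⇒Isomorphic G≗G′ = ↔-refl , G≗G′

  Isomorphic-sym : {G G′ : Graph n} → Isomorphic G G′ → Isomorphic G′ G
  Isomorphic-sym {G} {G′} (φ , φ-iso) = ↔-sym φ , λ x y → begin
    G′ x y                                   ≡⟨ cong₂ G′ (strictlyInverseˡ φ x) (strictlyInverseˡ φ y) ⟨
    G′ (to φ (from φ x)) (to φ (from φ y))   ≡⟨ φ-iso (from φ x) (from φ y) ⟨
    G (from φ x) (from φ y)                  ∎
    where open ≡-Reasoning

  Isomorphic-trans : {G G′ G″ : Graph n} → Isomorphic G G′ → Isomorphic G′ G″ → Isomorphic G G″
  Isomorphic-trans (φ , φ-iso) (ψ , ψ-iso) = ↔-trans φ ψ , λ x y → trans (φ-iso x y) (ψ-iso (to φ x) (to φ y))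

toggleIf : Bool → Bool → Bool
toggleIf b g = if b then not g else g

switchRule : ∀ {t} → Maybe (Fin t) → Maybe (Fin t) → Bool → (Fin t → Bool) → (Fin t → Bool) → Bool
switchRule nothing  (just i) g halfˣ halfʸ = toggleIf (halfˣ i) g
switchRule (just i) nothing  g halfˣ halfʸ = toggleIf (halfʸ i) g
switchRule _        _        g halfˣ halfʸ = g

gmSwitch-switchRule : ∀ {n t} (G : Graph n) (part : Vertex n → Maybe (Fin t)) x y →
  gmSwitch G part x y ≡ switchRule (part x) (part y) (G x y) (halfᵇ G part x) (halfᵇ G part y)
gmSwitch-switchRule G part x y with part x | part y
... | nothing | just _  = refl
... | just _  | nothing = refl
... | nothing | nothing = refl
... | just _  | just _  = refl

switchRule-cong : ∀ {t} (cx cy : Maybe (Fin t)) {g g′} {hx hx′ hy hy′ : Fin t → Bool} →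
  g ≡ g′ → (∀ i → hx i ≡ hx′ i) → (∀ i → hy i ≡ hy′ i) →
  switchRule cx cy g hx hy ≡ switchRule cx cy g′ hx′ hy′
switchRule-cong nothing  (just i) refl hx≗hx′ _ rewrite hx≗hx′ i = refl
switchRule-cong (just i) nothing  refl _ hy≗hy′ rewrite hy≗hy′ i = refl
switchRule-cong nothing  nothing  refl _ _ = refl
switchRule-cong (just _) (just _) refl _ _ = refl

gmSwitch-at : ∀ {n t} (G : Graph n) (part : Vertex n → Maybe (Fin t)) {x y cx cy} → part x ≡ cx → part y ≡ cy →
  gmSwitch G part x y ≡ switchRule cx cy (G x y) (halfᵇ G part x) (halfᵇ G part y)
gmSwitch-at G part {x} {y} x∈cx y∈cy = trans (gmSwitch-switchRule G part x y)
  (cong₂ (λ cx cy → switchRule cx cy (G x y) (halfᵇ G part x) (halfᵇ G part y)) x∈cx y∈cy)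

inPart-∘ : ∀ {n t} (part : Vertex n → Maybe (Fin t)) (f : Vertex n → Vertex n) c x →
  inPart (part ∘ f) c x ≡ inPart part c (f x)
inPart-∘ part f c x with part (f x)
... | just _  = refl
... | nothing = refl

module SwitchingTransport {n t} {G G′ : Graph n} (φ : Vertex n ↔ Vertex n)
  (φ-iso : ∀ x y → G x y ≡ G′ (to φ x) (to φ y)) (part : Vertex n → Maybe (Fin t)) where

  part′ : Vertex n → Maybe (Fin t)
  part′ = part ∘ from φ

  part′-to : ∀ x → part′ (to φ x) ≡ part x
  part′-to x = cong part (strictlyInverseʳ φ x)

  inPart′-to : ∀ c x → inPart part′ c (to φ x) ≡ inPart part c x
  inPart′-to c x = trans (inPart-∘ part (from φ) c (to φ x)) (cong (inPart part c) (strictlyInverseʳ φ x))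

  nbrsIn-to : ∀ x c → nbrsIn G′ part′ (to φ x) c ≡ nbrsIn G part x c
  nbrsIn-to x c = trans (sym (countV-permute φ (λ y → G′ (to φ x) y ∧ inPart part′ c y)))
                        (countV-cong (λ y → sym (cong₂ _∧_ (φ-iso x y) (sym (inPart′-to c y)))))

  nbrsIn-from : ∀ y c → nbrsIn G′ part′ y c ≡ nbrsIn G part (from φ y) c
  nbrsIn-from y c = trans (cong (λ z → nbrsIn G′ part′ z c) (sym (strictlyInverseˡ φ y))) (nbrsIn-to (from φ y) c)

  partSize′ : ∀ c → partSize part′ c ≡ partSize part c
  partSize′ c = trans (sym (countV-permute φ (inPart part′ c))) (countV-cong (inPart′-to c))

  halfᵇ-to : ∀ x c → halfᵇ G′ part′ (to φ x) c ≡ halfᵇ G part x c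
  halfᵇ-to x c = cong₂ (λ a s → ⌊ 2 * a ℕ.≟ s ⌋) (nbrsIn-to x c) (partSize′ c)

  isSwitchingPartition : IsSwitchingPartition G part → IsSwitchingPartition G′ part′
  isSwitchingPartition (nonempty , regular , threeValued) =
    (λ i → let (x , x∈Cᵢ) = nonempty i in to φ x , trans (part′-to x) x∈Cᵢ) ,
    (λ i j x y x∈Cᵢ y∈Cᵢ → trans (nbrsIn-from x j)
                              (trans (regular i j (from φ x) (from φ y) x∈Cᵢ y∈Cᵢ) (sym (nbrsIn-from y j)))) ,
    (λ y y∈D i → subst₂ (λ a s → a ≡ 0 ⊎ 2 * a ≡ s ⊎ a ≡ s) (sym (nbrsIn-from y i)) (sym (partSize′ i))
                        (threeValued (from φ y) y∈D i))

  gmSwitch-isomorphic : Isomorphic (gmSwitch G part) (gmSwitch G′ part′)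
  gmSwitch-isomorphic = φ , λ x y → begin
    gmSwitch G part x y
      ≡⟨ gmSwitch-switchRule G part x y ⟩
    switchRule (part x) (part y) (G x y) (halfᵇ G part x) (halfᵇ G part y)
      ≡⟨ switchRule-cong (part x) (part y) (φ-iso x y) (sym ∘ halfᵇ-to x) (sym ∘ halfᵇ-to y) ⟩
    switchRule (part x) (part y) (G′ (to φ x) (to φ y)) (halfᵇ G′ part′ (to φ x)) (halfᵇ G′ part′ (to φ y))
      ≡⟨ gmSwitch-at G′ part′ (part′-to x) (part′-to y) ⟨
    gmSwitch G′ part′ (to φ x) (to φ y) ∎
    where open ≡-Reasoning

==ᶠ-sym : ∀ {n} (k l : Fin n) → (k ==ᶠ l) ≡ (l ==ᶠ k)
==ᶠ-sym k l with k Fin.≟ l | l Fin.≟ k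
... | yes _   | yes _   = refl
... | no _    | no _    = refl
... | yes k≡l | no l≢k  = contradiction (sym k≡l) l≢k
... | no k≢l  | yes l≡k = contradiction (sym l≡k) k≢l

==ᶠ-injective : ∀ {m n} {f : Fin m → Fin n} → (∀ {k l} → f k ≡ f l → k ≡ l) →
                ∀ k l → (f k ==ᶠ f l) ≡ (k ==ᶠ l)
==ᶠ-injective {f = f} f-inj k l with f k Fin.≟ f l | k Fin.≟ l
... | yes _     | yes _   = refl
... | no _      | no _    = refl
... | yes fk≡fl | no k≢l  = contradiction (f-inj fk≡fl) k≢l
... | no fk≢fl  | yes k≡l = contradiction (cong f k≡l) fk≢fl

∧-==ᶠ-cong : ∀ {n} {a b : Bool} (k l : Fin n) → (k ≡ l → a ≡ b) → a ∧ (k ==ᶠ l) ≡ b ∧ (k ==ᶠ l)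
∧-==ᶠ-cong {a = a} {b} k l a≡b with k Fin.≟ l
... | yes k≡l = cong (_∧ true) (a≡b k≡l)
... | no _    = trans (∧-zeroʳ a) (sym (∧-zeroʳ b))

isRow : Layer → Bool
isRow V  = true
isRow V' = true
isRow W  = false
isRow W' = false

polarity : Layer → Bool
polarity V  = true
polarity V' = false
polarity W  = true
polarity W' = false

swapLayer : Layer → Layer
swapLayer V  = V'
swapLayer V' = V
swapLayer W  = W'
swapLayer W' = W

isRow-swapLayer : ∀ L → isRow (swapLayer L) ≡ isRow L
isRow-swapLayer V  = refl
isRow-swapLayer V' = refl
isRow-swapLayer W  = refl
isRow-swapLayer W' = refl

polarity-swapLayer : ∀ L → polarity (swapLayer L) ≡ not (polarity L)
polarity-swapLayer V  = refl
polarity-swapLayer V' = refl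
polarity-swapLayer W  = refl
polarity-swapLayer W' = refl

swapLayer-involutive : ∀ L → swapLayer (swapLayer L) ≡ L
swapLayer-involutive V  = refl
swapLayer-involutive V' = refl
swapLayer-involutive W  = refl
swapLayer-involutive W' = refl

infix 4 _==ᵇ_
_==ᵇ_ : Bool → Bool → Bool
true  ==ᵇ b = b
false ==ᵇ b = not b

hasSign : Bool → ℤ → Bool
hasSign b h = if b then isOne h else isMinusOne h

-- Hadamard-graph adjacency in terms of whether each endpoint is a row vertex (v, v′) and whether it is unprimed.
layerAdj : (row : Bool) (pol : Bool) (row′ : Bool) (pol′ : Bool) (sameIndex : Bool) (h : ℤ) → Bool
layerAdj true  p true  p′ same h = (p ==ᵇ p′) ∧ same
layerAdj false _ false _  same h = false
layerAdj true  p false p′ same h = hasSign (p ==ᵇ p′) h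
layerAdj false p true  p′ same h = hasSign (p ==ᵇ p′) h

entry : ∀ {n} → Matrix n → Bool → Fin n → Fin n → ℤ
entry N row k l = if row then N k l else N l k

hadamardGraph-layerAdj : ∀ {n} (N : Matrix n) L k L′ l →
  hadamardGraph N (L , k) (L′ , l) ≡ layerAdj (isRow L) (polarity L) (isRow L′) (polarity L′) (k ==ᶠ l) (entry N (isRow L) k l)
hadamardGraph-layerAdj N V  k V  l = refl
hadamardGraph-layerAdj N V  k V' l = refl
hadamardGraph-layerAdj N V  k W  l = refl
hadamardGraph-layerAdj N V  k W' l = refl
hadamardGraph-layerAdj N V' k V  l = refl
hadamardGraph-layerAdj N V' k V' l = refl
hadamardGraph-layerAdj N V' k W  l = refl
hadamardGraph-layerAdj N V' k W' l = refl
hadamardGraph-layerAdj N W  k V  l = refl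
hadamardGraph-layerAdj N W  k V' l = refl
hadamardGraph-layerAdj N W  k W  l = refl
hadamardGraph-layerAdj N W  k W' l = refl
hadamardGraph-layerAdj N W' k V  l = refl
hadamardGraph-layerAdj N W' k V' l = refl
hadamardGraph-layerAdj N W' k W  l = refl
hadamardGraph-layerAdj N W' k W' l = refl

hadamardGraph-sym : ∀ {n} (N : Matrix n) x y → hadamardGraph N x y ≡ hadamardGraph N y x
hadamardGraph-sym N (V  , k) (V  , l) = ==ᶠ-sym k l
hadamardGraph-sym N (V  , k) (V' , l) = refl
hadamardGraph-sym N (V  , k) (W  , l) = refl
hadamardGraph-sym N (V  , k) (W' , l) = refl
hadamardGraph-sym N (V' , k) (V  , l) = refl
hadamardGraph-sym N (V' , k) (V' , l) = ==ᶠ-sym k l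
hadamardGraph-sym N (V' , k) (W  , l) = refl
hadamardGraph-sym N (V' , k) (W' , l) = refl
hadamardGraph-sym N (W  , k) (V  , l) = refl
hadamardGraph-sym N (W  , k) (V' , l) = refl
hadamardGraph-sym N (W  , k) (W  , l) = refl
hadamardGraph-sym N (W  , k) (W' , l) = refl
hadamardGraph-sym N (W' , k) (V  , l) = refl
hadamardGraph-sym N (W' , k) (V' , l) = refl
hadamardGraph-sym N (W' , k) (W  , l) = refl
hadamardGraph-sym N (W' , k) (W' , l) = refl

hadamardGraph-swapLayer : ∀ {n} (N : Matrix n) L k L′ l →
  hadamardGraph N (L , k) (L′ , l) ≡ hadamardGraph N (swapLayer L , k) (swapLayer L′ , l)
hadamardGraph-swapLayer N V  k V  l = refl
hadamardGraph-swapLayer N V  k V' l = refl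
hadamardGraph-swapLayer N V  k W  l = refl
hadamardGraph-swapLayer N V  k W' l = refl
hadamardGraph-swapLayer N V' k V  l = refl
hadamardGraph-swapLayer N V' k V' l = refl
hadamardGraph-swapLayer N V' k W  l = refl
hadamardGraph-swapLayer N V' k W' l = refl
hadamardGraph-swapLayer N W  k V  l = refl
hadamardGraph-swapLayer N W  k V' l = refl
hadamardGraph-swapLayer N W  k W  l = refl
hadamardGraph-swapLayer N W  k W' l = refl
hadamardGraph-swapLayer N W' k V  l = refl
hadamardGraph-swapLayer N W' k V' l = refl
hadamardGraph-swapLayer N W' k W  l = refl
hadamardGraph-swapLayer N W' k W' l = refl

hadamardGraph-entries : ∀ {n} (N N′ : Matrix n) L k L′ l → N k l ≡ N′ k l → N l k ≡ N′ l k →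
  hadamardGraph N (L , k) (L′ , l) ≡ hadamardGraph N′ (L , k) (L′ , l)
hadamardGraph-entries N N′ L k L′ l Nkl≡ Nlk≡
  rewrite hadamardGraph-layerAdj N L k L′ l | hadamardGraph-layerAdj N′ L k L′ l =
  cong (layerAdj (isRow L) (polarity L) (isRow L′) (polarity L′) (k ==ᶠ l)) (entry≡ (isRow L))
  where
  entry≡ : ∀ row → entry N row k l ≡ entry N′ row k l
  entry≡ true  = Nkl≡
  entry≡ false = Nlk≡

isOne-neg : ∀ h → isOne (ℤ.- h) ≡ isMinusOne h
isOne-neg (ℤ.+ 0)             = refl
isOne-neg (ℤ.+ 1)             = refl
isOne-neg (ℤ.+ suc (suc _))   = refl
isOne-neg ℤ.-[1+ 0 ]          = refl
isOne-neg ℤ.-[1+ suc _ ]      = refl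

isMinusOne-neg : ∀ h → isMinusOne (ℤ.- h) ≡ isOne h
isMinusOne-neg (ℤ.+ 0)           = refl
isMinusOne-neg (ℤ.+ 1)           = refl
isMinusOne-neg (ℤ.+ suc (suc _)) = refl
isMinusOne-neg ℤ.-[1+ 0 ]        = refl
isMinusOne-neg ℤ.-[1+ suc _ ]    = refl

hasSign-neg : ∀ b h → hasSign b (ℤ.- h) ≡ hasSign (not b) h
hasSign-neg true  h = isOne-neg h
hasSign-neg false h = isMinusOne-neg h

not-==ᵇʳ : ∀ p q → not (p ==ᵇ q) ≡ (p ==ᵇ not q)
not-==ᵇʳ true  q = refl
not-==ᵇʳ false q = refl

not-==ᵇˡ : ∀ p q → not (p ==ᵇ q) ≡ (not p ==ᵇ q)
not-==ᵇˡ true  q = refl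
not-==ᵇˡ false q = not-involutive q

==ᵇ-not : ∀ p q → (not p ==ᵇ not q) ≡ (p ==ᵇ q)
==ᵇ-not true  q = not-involutive q
==ᵇ-not false q = refl

hasSign-sign : ∀ a b p p′ h → hasSign (p ==ᵇ p′) (sign a ℤ.* sign b ℤ.* h) ≡ hasSign ((a ==ᵇ p) ==ᵇ (b ==ᵇ p′)) h
hasSign-sign true  true  p p′ h = cong (hasSign (p ==ᵇ p′)) (ℤ.*-identityˡ h)
hasSign-sign true  false p p′ h = trans (cong (hasSign (p ==ᵇ p′)) (ℤ.-1*i≡-i h))
  (trans (hasSign-neg (p ==ᵇ p′) h) (cong (λ b → hasSign b h) (not-==ᵇʳ p p′)))
hasSign-sign false true  p p′ h = trans (cong (hasSign (p ==ᵇ p′)) (ℤ.-1*i≡-i h))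
  (trans (hasSign-neg (p ==ᵇ p′) h) (cong (λ b → hasSign b h) (not-==ᵇˡ p p′)))
hasSign-sign false false p p′ h = trans (cong (hasSign (p ==ᵇ p′)) (ℤ.*-identityˡ h))
  (cong (λ b → hasSign b h) (sym (==ᵇ-not p p′)))

-- Equivalent matrices have isomorphic Hadamard graphs

flipLayer : Bool → Layer → Layer
flipLayer b L = if b then L else swapLayer L

isRow-flipLayer : ∀ b L → isRow (flipLayer b L) ≡ isRow L
isRow-flipLayer true  L = refl
isRow-flipLayer false L = isRow-swapLayer L

polarity-flipLayer : ∀ b L → polarity (flipLayer b L) ≡ (b ==ᵇ polarity L)
polarity-flipLayer true  L = refl
polarity-flipLayer false L = polarity-swapLayer L

flipLayer-involutive : ∀ b L → flipLayer b (flipLayer b L) ≡ L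
flipLayer-involutive true  L = refl
flipLayer-involutive false L = swapLayer-involutive L

==ᵇ-cancelˡ : ∀ a p p′ → ((a ==ᵇ p) ==ᵇ (a ==ᵇ p′)) ≡ (p ==ᵇ p′)
==ᵇ-cancelˡ true  p p′ = refl
==ᵇ-cancelˡ false p p′ = ==ᵇ-not p p′

-- Negating row k of M (r k = false) exchanges the vertices v_k and v'_k, and similarly for columns.
module EquivalenceIsomorphism {n} (H M : Matrix n) (σ τ : Fin n ↔ Fin n) (r c : Fin n → Bool)
  (M≡ : ∀ k l → M k l ≡ sign (r k) ℤ.* sign (c l) ℤ.* H (to σ k) (to τ l)) where

  lineSign : Bool → Fin n → Bool
  lineSign row = if row then r else c

  linePerm : Bool → Fin n ↔ Fin n
  linePerm row = if row then σ else τ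

  ψ : Vertex n → Vertex n
  ψ (L , k) = flipLayer (lineSign (isRow L) k) L , to (linePerm (isRow L)) k

  ψ⁻¹ : Vertex n → Vertex n
  ψ⁻¹ (L , k) = flipLayer (lineSign (isRow L) k₀) L , k₀
    where k₀ = from (linePerm (isRow L)) k

  ψ∘ψ⁻¹ : ∀ x → ψ (ψ⁻¹ x) ≡ x
  ψ∘ψ⁻¹ (L , k) rewrite isRow-flipLayer (lineSign (isRow L) (from (linePerm (isRow L)) k)) L =
    cong₂ _,_ (flipLayer-involutive (lineSign (isRow L) (from (linePerm (isRow L)) k)) L)
              (strictlyInverseˡ (linePerm (isRow L)) k)

  ψ⁻¹∘ψ : ∀ x → ψ⁻¹ (ψ x) ≡ x
  ψ⁻¹∘ψ (L , k) rewrite isRow-flipLayer (lineSign (isRow L) k) L | strictlyInverseʳ (linePerm (isRow L)) k =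
    cong (_, k) (flipLayer-involutive (lineSign (isRow L) k) L)

  layerAdj-equivalent : ∀ row p row′ p′ k l →
    layerAdj row p row′ p′ (k ==ᶠ l) (entry M row k l) ≡
    layerAdj row (lineSign row k ==ᵇ p) row′ (lineSign row′ l ==ᵇ p′)
             (to (linePerm row) k ==ᶠ to (linePerm row′) l) (entry H row (to (linePerm row) k) (to (linePerm row′) l))
  layerAdj-equivalent true  p true  p′ k l =
    trans (∧-==ᶠ-cong k l λ { refl → sym (==ᵇ-cancelˡ (r k) p p′) })
          (cong (((r k ==ᵇ p) ==ᵇ (r l ==ᵇ p′)) ∧_) (sym (==ᶠ-injective (Injection.injective (↔⇒↣ σ)) k l)))
  layerAdj-equivalent true  p false p′ k l rewrite M≡ k l = hasSign-sign (r k) (c l) p p′ _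
  layerAdj-equivalent false p true  p′ k l rewrite M≡ l k | ℤ.*-comm (sign (r l)) (sign (c k)) =
    hasSign-sign (c k) (r l) p p′ _
  layerAdj-equivalent false p false p′ k l = refl

  hadamardGraph-ψ : ∀ x y → hadamardGraph M x y ≡ hadamardGraph H (ψ x) (ψ y)
  hadamardGraph-ψ (L , k) (L′ , l)
    rewrite hadamardGraph-layerAdj M L k L′ l
          | hadamardGraph-layerAdj H (proj₁ (ψ (L , k))) (proj₂ (ψ (L , k))) (proj₁ (ψ (L′ , l))) (proj₂ (ψ (L′ , l)))
          | isRow-flipLayer (lineSign (isRow L) k) L | isRow-flipLayer (lineSign (isRow L′) l) L′
          | polarity-flipLayer (lineSign (isRow L) k) L | polarity-flipLayer (lineSign (isRow L′) l) L′ =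
    layerAdj-equivalent (isRow L) (polarity L) (isRow L′) (polarity L′) k l

Equivalent⇒Isomorphic : ∀ {n} {H M : Matrix n} → Equivalent H M → Isomorphic (hadamardGraph M) (hadamardGraph H)
Equivalent⇒Isomorphic {H = H} {M} (σ , τ , r , c , M≡) = mk↔ₛ′ ψ ψ⁻¹ ψ∘ψ⁻¹ ψ⁻¹∘ψ , hadamardGraph-ψ
  where open EquivalenceIsomorphism H M σ τ r c M≡

allLayers? : {P : Layer → Set} → (∀ L → Dec (P L)) → Dec (∀ L → P L)
allLayers? P? = map′ (λ { (pV , pV' , pW , pW') → λ { V → pV ; V' → pV' ; W → pW ; W' → pW' } })
                     (λ p → p V , p V' , p W , p W')
                     (P? V ×-dec P? V' ×-dec P? W ×-dec P? W')

-- Adjacency of a vertex in layer L to the Hall vertex (L′ , a), where same a tells whether the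
-- vertex has index a and v a is its matrix entry against the Hall line a.
hallAdj : Layer → (Fin 4 → Bool) → (Fin 4 → ℤ) → Layer → Fin 4 → Bool
hallAdj L same v L′ a = layerAdj (isRow L) (polarity L) (isRow L′) (polarity L′) (same a) (v a)

hallCount : (Layer → Fin 4 → Bool) → ℕ
hallCount p = countFin (p V) + countFin (p V') + countFin (p W) + countFin (p W')

hallClass : Fin 4 → Layer → Fin 4 → Fin 4
hallClass i V  a = if isOne (fRow i a) then 0F else 1F
hallClass i V' a = if isOne (fRow i a) then 1F else 0F
hallClass i W  a = if isOne (gSign i ℤ.* fRow i a) then 2F else 3F
hallClass i W' a = if isOne (gSign i ℤ.* fRow i a) then 3F else 2F

classRep : Fin 4 → Fin 4 → Layer
classRep i 0F = if isOne (fRow i 0F) then V else V'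
classRep i 1F = if isOne (fRow i 0F) then V' else V
classRep i 2F = if isOne (gSign i ℤ.* fRow i 0F) then W else W'
classRep i 3F = if isOne (gSign i ℤ.* fRow i 0F) then W' else W

classCount : Fin 4 → Layer → (Fin 4 → Bool) → (Fin 4 → ℤ) → Fin 4 → ℕ
classCount i L same v c = hallCount (λ L′ a → hallAdj L same v L′ a ∧ (hallClass i L′ a ==ᶠ c))

hallCount-cong : ∀ {p q : Layer → Fin 4 → Bool} → (∀ L a → p L a ≡ q L a) → hallCount p ≡ hallCount q
hallCount-cong p≗q = cong₂ _+_ (cong₂ _+_ (cong₂ _+_ (countFin-cong (p≗q V)) (countFin-cong (p≗q V'))) (countFin-cong (p≗q W)))
                             (countFin-cong (p≗q W'))

classCount-cong : ∀ i L {same same′ v v′} c → (∀ a → same a ≡ same′ a) → (∀ a → v a ≡ v′ a) →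
  classCount i L same v c ≡ classCount i L same′ v′ c
classCount-cong i L c same≗ v≗ = hallCount-cong λ L′ a →
  cong (_∧ (hallClass i L′ a ==ᶠ c)) (cong₂ (layerAdj (isRow L) (polarity L) (isRow L′) (polarity L′)) (same≗ a) (v≗ a))

hallNbrs : Fin 4 → Layer → Fin 4 → Fin 4 → ℕ
hallNbrs i L b = classCount i L (b ==ᶠ_) (entry h4 (isRow L) b)

blockEntry : Fin 4 → Bool → Fin 4 → ℤ
blockEntry j row a = if row then gSign j ℤ.* fRow j a else fRow j a

switchedBlockEntry : Fin 4 → Fin 4 → Bool → Fin 4 → ℤ
switchedBlockEntry i j row a = if i ==ᶠ j then ℤ.- blockEntry j row a else blockEntry j row a

blockNbrs : Fin 4 → Layer → Fin 4 → Fin 4 → ℕ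
blockNbrs i L j = classCount i L (λ _ → false) (blockEntry j (isRow L))

-- The following facts only involve the 4 × 4 data H₄, F_j, G_j and are decided by evaluation.
classRep-hallClass : ∀ i c → hallClass i (classRep i c) 0F ≡ c
classRep-hallClass = from-yes (all? λ i → all? λ c → hallClass i (classRep i c) 0F Fin.≟ c)

hallClass-size : ∀ i c → hallCount (λ L a → hallClass i L a ==ᶠ c) ≡ 4
hallClass-size = from-yes (all? λ i → all? λ c → hallCount (λ L a → hallClass i L a ==ᶠ c) ℕ.≟ 4)

hallNbrs-classRep : ∀ i L b c → hallNbrs i L b c ≡ hallNbrs i (classRep i (hallClass i L b)) 0F c
hallNbrs-classRep = from-yes (all? λ i → allLayers? λ L → all? λ b → all? λ c →
  hallNbrs i L b c ℕ.≟ hallNbrs i (classRep i (hallClass i L b)) 0F c)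

blockNbrs-0-2-4 : ∀ i L j c → blockNbrs i L j c ≡ 0 ⊎ 2 * blockNbrs i L j c ≡ 4 ⊎ blockNbrs i L j c ≡ 4
blockNbrs-0-2-4 = from-yes (all? λ i → allLayers? λ L → all? λ j → all? λ c →
  (blockNbrs i L j c ℕ.≟ 0) ⊎-dec (2 * blockNbrs i L j c ℕ.≟ 4) ⊎-dec (blockNbrs i L j c ℕ.≟ 4))

blockAdj-switched : ∀ i L′ j L a →
  toggleIf ⌊ 2 * blockNbrs i L′ j (hallClass i L a) ℕ.≟ 4 ⌋ (hallAdj L′ (λ _ → false) (blockEntry j (isRow L′)) L a)
  ≡ hallAdj L′ (λ _ → false) (switchedBlockEntry i j (isRow L′)) (swapLayer L) a
blockAdj-switched = from-yes (all? λ i → allLayers? λ L′ → all? λ j → allLayers? λ L → all? λ a →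
  toggleIf ⌊ 2 * blockNbrs i L′ j (hallClass i L a) ℕ.≟ 4 ⌋ (hallAdj L′ (λ _ → false) (blockEntry j (isRow L′)) L a)
  Bool.≟ hallAdj L′ (λ _ → false) (switchedBlockEntry i j (isRow L′)) (swapLayer L) a)

n%8≡4⇒hallSize : ∀ n′ → (4 + n′) % 8 ≡ 4 → n′ ≡ 4 * hallM (4 + n′)
n%8≡4⇒hallSize n′ n%8≡4 = begin
  n′                             ≡⟨ ℕ.+-cancelˡ-≡ 4 n′ (q * 8) n≡4+8q ⟩
  q * 8                          ≡⟨ regroup q ⟩
  4 * (2 * q)                    ≡⟨ cong (λ x → 4 * (x ∸ 1)) (m*n/n≡m (suc (2 * q)) 4) ⟨
  4 * (suc (2 * q) * 4 / 4 ∸ 1)  ≡⟨ cong (λ x → 4 * (x / 4 ∸ 1)) 4[2q+1]≡n ⟩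
  4 * hallM (4 + n′)             ∎
  where
  open ≡-Reasoning
  q : ℕ
  q = (4 + n′) / 8
  n≡4+8q : 4 + n′ ≡ 4 + q * 8
  n≡4+8q = trans (m≡m%n+[m/n]*n (4 + n′) 8) (cong (_+ q * 8) n%8≡4)
  regroup : ∀ q → q * 8 ≡ 4 * (2 * q)
  regroup = solve-∀
  distrib : ∀ q → suc (2 * q) * 4 ≡ 4 + q * 8
  distrib = solve-∀
  4[2q+1]≡n : suc (2 * q) * 4 ≡ 4 + n′
  4[2q+1]≡n = trans (distrib q) (sym n≡4+8q)

fRow-injective : ∀ j j′ → (∀ a → fRow j a ≡ fRow j′ a) → j ≡ j′
fRow-injective = from-yes (all? λ j → all? λ j′ → (all? λ a → fRow j a ℤ.≟ fRow j′ a) →-dec (j Fin.≟ j′))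

inBlockᵇ-combine : ∀ m (j : Fin 4) (r : Fin m) → T (inBlockᵇ m j (4 + toℕ (combine j r)))
inBlockᵇ-combine m j r = Equivalence.from T-∧ (ℕ.≤⇒≤ᵇ (ℕ.+-monoʳ-≤ 4 lower) , ℕ.<⇒<ᵇ (ℕ.+-monoʳ-< 4 upper))
  where
  open ℕ.≤-Reasoning
  lower : toℕ j * m ≤ toℕ (combine j r)
  lower = begin
    toℕ j * m          ≡⟨ ℕ.*-comm (toℕ j) m ⟩
    m * toℕ j          ≤⟨ ℕ.m≤m+n (m * toℕ j) (toℕ r) ⟩
    m * toℕ j + toℕ r  ≡⟨ Fin.toℕ-combine j r ⟨
    toℕ (combine j r)  ∎
  upper : toℕ (combine j r) < suc (toℕ j) * m
  upper = begin-strict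
    toℕ (combine j r)  ≡⟨ Fin.toℕ-combine j r ⟩
    m * toℕ j + toℕ r  <⟨ ℕ.+-monoʳ-< (m * toℕ j) (Fin.toℕ<n r) ⟩
    m * toℕ j + m      ≡⟨ ℕ.+-comm (m * toℕ j) m ⟩
    m + m * toℕ j      ≡⟨ cong (m +_) (ℕ.*-comm m (toℕ j)) ⟩
    suc (toℕ j) * m    ∎

¬T⇒≡false : ∀ {b} → ¬ T b → b ≡ false
¬T⇒≡false {false} _  = refl
¬T⇒≡false {true}  ¬t = contradiction _ ¬t

module BlockStructure {n′ : ℕ} (m : ℕ) (n′≡4m : n′ ≡ 4 * m) (M : Matrix (4 + n′))
  (F-block : ∀ (a j : Fin 4) (k l : Fin (4 + n′)) → toℕ k ≡ toℕ a → T (inBlockᵇ m j (toℕ l)) → M k l ≡ fRow j a)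
  where

  blockPosition : Fin n′ → Fin 4 × Fin m
  blockPosition k = remQuot {4} m (Fin.cast n′≡4m k)

  block : Fin n′ → Fin 4
  block = proj₁ ∘ blockPosition

  inBlock-block : ∀ k → T (inBlockᵇ m (block k) (4 + toℕ k))
  inBlock-block k =
    subst (λ t → T (inBlockᵇ m (block k) (4 + t))) combine≡k (inBlockᵇ-combine m (block k) (proj₂ (blockPosition k)))
    where
    combine≡k : toℕ (combine (block k) (proj₂ (blockPosition k))) ≡ toℕ k
    combine≡k = trans (cong toℕ (Fin.combine-remQuot {4} m (Fin.cast n′≡4m k))) (Fin.toℕ-cast _ k)

  -- The Hall entries of a column in block j form the column of F_j, and distinct F_j have distinct columns.
  block-unique : ∀ j k → T (inBlockᵇ m j (4 + toℕ k)) → j ≡ block k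
  block-unique j k k∈j = fRow-injective j (block k) λ a → trans
    (sym (F-block a j (a ↑ˡ n′) (4 ↑ʳ k) (Fin.toℕ-↑ˡ a n′) k∈j))
    (F-block a (block k) (a ↑ˡ n′) (4 ↑ʳ k) (Fin.toℕ-↑ˡ a n′) (inBlock-block k))

  inBlockᵇ-block : ∀ j k → inBlockᵇ m j (4 + toℕ k) ≡ (j ==ᶠ block k)
  inBlockᵇ-block j k with j Fin.≟ block k
  ... | yes refl = Equivalence.to T-≡ (inBlock-block k)
  ... | no j≢    = ¬T⇒≡false (j≢ ∘ block-unique j k)

-- Switching a Hall set is GM-switching

switchHall-if : ∀ {n} i (M : Matrix n) k l {b} →
  (isHallᵇ (toℕ k) ∧ inBlockᵇ (hallM n) i (toℕ l)) ∨ (inBlockᵇ (hallM n) i (toℕ k) ∧ isHallᵇ (toℕ l)) ≡ b →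
  switchHall i M k l ≡ (if b then ℤ.- M k l else M k l)
switchHall-if i M k l switched≡b = cong (λ b → if b then ℤ.- M k l else M k l) switched≡b

module HallSwitching {n′ : ℕ} (n%8≡4 : (4 + n′) % 8 ≡ 4) (M : Matrix (4 + n′))
  (H₄-block : ∀ (a b : Fin 4) (k l : Fin (4 + n′)) → toℕ k ≡ toℕ a → toℕ l ≡ toℕ b → M k l ≡ h4 a b)
  (F-block : ∀ (a j : Fin 4) (k l : Fin (4 + n′)) → toℕ k ≡ toℕ a → T (inBlockᵇ (hallM (4 + n′)) j (toℕ l)) →
             M k l ≡ fRow j a)
  (G-block : ∀ (a j : Fin 4) (k l : Fin (4 + n′)) → T (inBlockᵇ (hallM (4 + n′)) j (toℕ k)) → toℕ l ≡ toℕ a →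
             M k l ≡ gSign j ℤ.* fRow j a)
  (i : Fin 4) where

  m : ℕ
  m = hallM (4 + n′)

  open BlockStructure m (n%8≡4⇒hallSize n′ n%8≡4) M F-block

  G G′ : Graph (4 + n′)
  G  = hadamardGraph M
  G′ = hadamardGraph (switchHall i M)

  hallIdx : Fin 4 → Fin (4 + n′)
  hallIdx a = a ↑ˡ n′

  farIdx : Fin n′ → Fin (4 + n′)
  farIdx k = 4 ↑ʳ k

  data HallOrFar : Fin (4 + n′) → Set where
    hall : ∀ a → HallOrFar (hallIdx a)
    far  : ∀ k → HallOrFar (farIdx k)

  hallOrFar : ∀ k → HallOrFar k
  hallOrFar 0F = hall 0F
  hallOrFar 1F = hall 1F
  hallOrFar 2F = hall 2F
  hallOrFar 3F = hall 3F
  hallOrFar (suc (suc (suc (suc k)))) = far k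

  farIdx≢hallIdx : ∀ k a → (farIdx k ==ᶠ hallIdx a) ≡ false
  farIdx≢hallIdx k 0F = refl
  farIdx≢hallIdx k 1F = refl
  farIdx≢hallIdx k 2F = refl
  farIdx≢hallIdx k 3F = refl

  isHallᵇ-hallIdx : ∀ a → isHallᵇ (toℕ (hallIdx a)) ≡ true
  isHallᵇ-hallIdx 0F = refl
  isHallᵇ-hallIdx 1F = refl
  isHallᵇ-hallIdx 2F = refl
  isHallᵇ-hallIdx 3F = refl

  inBlockᵇ-hallIdx : ∀ a → inBlockᵇ m i (toℕ (hallIdx a)) ≡ false
  inBlockᵇ-hallIdx 0F = refl
  inBlockᵇ-hallIdx 1F = refl
  inBlockᵇ-hallIdx 2F = refl
  inBlockᵇ-hallIdx 3F = refl

  partition : Vertex (4 + n′) → Maybe (Fin 4)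
  partition (L , 0F) = just (hallClass i L 0F)
  partition (L , 1F) = just (hallClass i L 1F)
  partition (L , 2F) = just (hallClass i L 2F)
  partition (L , 3F) = just (hallClass i L 3F)
  partition (L , suc (suc (suc (suc k)))) = nothing

  partition-hall : ∀ L a → partition (L , hallIdx a) ≡ just (hallClass i L a)
  partition-hall L 0F = refl
  partition-hall L 1F = refl
  partition-hall L 2F = refl
  partition-hall L 3F = refl

  inPart-hall : ∀ c L a → inPart partition c (L , hallIdx a) ≡ (hallClass i L a ==ᶠ c)
  inPart-hall c L 0F = refl
  inPart-hall c L 1F = refl
  inPart-hall c L 2F = refl
  inPart-hall c L 3F = refl

  χ : Vertex (4 + n′) → Vertex (4 + n′)
  χ (L , k) = (if isHallᵇ (toℕ k) then swapLayer L else L) , k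

  χ-involutive : ∀ x → χ (χ x) ≡ x
  χ-involutive (L , k) with isHallᵇ (toℕ k)
  ... | true  = cong (_, k) (swapLayer-involutive L)
  ... | false = refl

  χ-hall : ∀ L a → χ (L , hallIdx a) ≡ (swapLayer L , hallIdx a)
  χ-hall L a rewrite isHallᵇ-hallIdx a = refl

  countFin-hall : (p : Fin (4 + n′) → Bool) → (∀ k → p (farIdx k) ≡ false) → countFin p ≡ countFin (p ∘ hallIdx)
  countFin-hall p far-false rewrite countFin-false (p ∘ farIdx) far-false = refl

  countV-hall : (q : Vertex (4 + n′) → Bool) → (∀ L k → q (L , farIdx k) ≡ false) →
    countV q ≡ hallCount (λ L a → q (L , hallIdx a))
  countV-hall q far-false = cong₂ _+_ (cong₂ _+_ (cong₂ _+_ (count V) (count V')) (count W)) (count W')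
    where
    count : ∀ L → countFin (q ∘ (L ,_)) ≡ countFin (q ∘ (L ,_) ∘ hallIdx)
    count L = countFin-hall (q ∘ (L ,_)) (far-false L)

  hallEntries : Matrix (4 + n′) → Vertex (4 + n′) → Fin 4 → ℤ
  hallEntries X (L , k) a = entry X (isRow L) k (hallIdx a)

  nbrsIn-classCount : ∀ L k c → nbrsIn G partition (L , k) c ≡ classCount i L (λ a → k ==ᶠ hallIdx a) (hallEntries M (L , k)) c
  nbrsIn-classCount L k c =
    trans (countV-hall (λ y → G (L , k) y ∧ inPart partition c y) (λ _ _ → ∧-zeroʳ _))
          (hallCount-cong λ L′ a → cong₂ _∧_ (hadamardGraph-layerAdj M L k L′ (hallIdx a)) (inPart-hall c L′ a))

  partSize-partition : ∀ c → partSize partition c ≡ 4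
  partSize-partition c =
    trans (countV-hall (inPart partition c) (λ _ _ → refl)) (trans (hallCount-cong (inPart-hall c)) (hallClass-size i c))

  hallEntries-hall : ∀ L b a → hallEntries M (L , hallIdx b) a ≡ entry h4 (isRow L) b a
  hallEntries-hall L b a = entry-hall (isRow L)
    where
    entry-hall : ∀ row → entry M row (hallIdx b) (hallIdx a) ≡ entry h4 row b a
    entry-hall true  = H₄-block b a (hallIdx b) (hallIdx a) (Fin.toℕ-↑ˡ b n′) (Fin.toℕ-↑ˡ a n′)
    entry-hall false = H₄-block a b (hallIdx a) (hallIdx b) (Fin.toℕ-↑ˡ a n′) (Fin.toℕ-↑ˡ b n′)

  hallEntries-far : ∀ L k a → hallEntries M (L , farIdx k) a ≡ blockEntry (block k) (isRow L) a
  hallEntries-far L k a = entry-far (isRow L)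
    where
    entry-far : ∀ row → entry M row (farIdx k) (hallIdx a) ≡ blockEntry (block k) row a
    entry-far true  = G-block a (block k) (farIdx k) (hallIdx a) (inBlock-block k) (Fin.toℕ-↑ˡ a n′)
    entry-far false = F-block a (block k) (hallIdx a) (farIdx k) (Fin.toℕ-↑ˡ a n′) (inBlock-block k)

  nbrsIn-hall : ∀ L b c → nbrsIn G partition (L , hallIdx b) c ≡ hallNbrs i L b c
  nbrsIn-hall L b c = trans (nbrsIn-classCount L (hallIdx b) c)
    (classCount-cong i L c (λ a → ==ᶠ-injective (Fin.↑ˡ-injective n′ _ _) b a) (hallEntries-hall L b))

  nbrsIn-far : ∀ L k c → nbrsIn G partition (L , farIdx k) c ≡ blockNbrs i L (block k) c
  nbrsIn-far L k c = trans (nbrsIn-classCount L (farIdx k) c)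
    (classCount-cong i L c (farIdx≢hallIdx k) (hallEntries-far L k))

  nbrsIn-class : ∀ x c c′ → partition x ≡ just c → nbrsIn G partition x c′ ≡ hallNbrs i (classRep i c) 0F c′
  nbrsIn-class (L , k) c c′ x∈C with hallOrFar k
  ... | hall b = begin
    nbrsIn G partition (L , hallIdx b) c′              ≡⟨ nbrsIn-hall L b c′ ⟩
    hallNbrs i L b c′                                  ≡⟨ hallNbrs-classRep i L b c′ ⟩
    hallNbrs i (classRep i (hallClass i L b)) 0F c′    ≡⟨ cong (λ c → hallNbrs i (classRep i c) 0F c′)
                                                            (just-injective (trans (sym (partition-hall L b)) x∈C)) ⟩
    hallNbrs i (classRep i c) 0F c′                    ∎
    where open ≡-Reasoning
  ... | far _ with () ← x∈C

  isSwitchingPartition : IsSwitchingPartition G partition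
  isSwitchingPartition =
    (λ c → (classRep i c , 0F) , cong just (classRep-hallClass i c)) ,
    (λ c c′ x y x∈C y∈C → trans (nbrsIn-class x c c′ x∈C) (sym (nbrsIn-class y c c′ y∈C))) ,
    threeValued
    where
    threeValued : ∀ x → partition x ≡ nothing → ∀ c →
      nbrsIn G partition x c ≡ 0 ⊎ 2 * nbrsIn G partition x c ≡ partSize partition c ⊎ nbrsIn G partition x c ≡ partSize partition c
    threeValued (L , k) x∈D c with hallOrFar k
    ... | hall a with () ← trans (sym (partition-hall L a)) x∈D
    ... | far k′ = subst₂ (λ a s → a ≡ 0 ⊎ 2 * a ≡ s ⊎ a ≡ s) (sym (nbrsIn-far L k′ c)) (sym (partSize-partition c))
                          (blockNbrs-0-2-4 i L (block k′) c)

  switchHall-hall-hall : ∀ a b → switchHall i M (hallIdx a) (hallIdx b) ≡ M (hallIdx a) (hallIdx b)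
  switchHall-hall-hall a b = switchHall-if i M (hallIdx a) (hallIdx b)
    (cong₂ _∨_ (trans (cong (isHallᵇ (toℕ (hallIdx a)) ∧_) (inBlockᵇ-hallIdx b)) (∧-zeroʳ _))
               (cong (_∧ isHallᵇ (toℕ (hallIdx b))) (inBlockᵇ-hallIdx a)))

  switchHall-far-far : ∀ k l → switchHall i M (farIdx k) (farIdx l) ≡ M (farIdx k) (farIdx l)
  switchHall-far-far k l = switchHall-if i M (farIdx k) (farIdx l) (∧-zeroʳ (inBlockᵇ m i (4 + toℕ k)))

  switchHall-far-hall : ∀ k a → switchHall i M (farIdx k) (hallIdx a) ≡
    (if i ==ᶠ block k then ℤ.- M (farIdx k) (hallIdx a) else M (farIdx k) (hallIdx a))
  switchHall-far-hall k a = switchHall-if i M (farIdx k) (hallIdx a)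
    (trans (cong₂ _∧_ (inBlockᵇ-block i k) (isHallᵇ-hallIdx a)) (∧-identityʳ _))

  switchHall-hall-far : ∀ k a → switchHall i M (hallIdx a) (farIdx k) ≡
    (if i ==ᶠ block k then ℤ.- M (hallIdx a) (farIdx k) else M (hallIdx a) (farIdx k))
  switchHall-hall-far k a = switchHall-if i M (hallIdx a) (farIdx k)
    (trans (cong₂ _∨_ (cong₂ _∧_ (isHallᵇ-hallIdx a) (inBlockᵇ-block i k)) (∧-zeroʳ _)) (∨-identityʳ _))

  hallEntries-far-switched : ∀ L k a → hallEntries (switchHall i M) (L , farIdx k) a ≡ switchedBlockEntry i (block k) (isRow L) a
  hallEntries-far-switched L k a = entry-far (isRow L)
    where
    negateIf : ℤ → ℤ
    negateIf h = if i ==ᶠ block k then ℤ.- h else h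
    entry-far : ∀ row → entry (switchHall i M) row (farIdx k) (hallIdx a) ≡ switchedBlockEntry i (block k) row a
    entry-far true  = trans (switchHall-far-hall k a) (cong negateIf (hallEntries-far V k a))
    entry-far false = trans (switchHall-hall-far k a) (cong negateIf (hallEntries-far W k a))

  hadamardGraph-far-hall : ∀ X {v} L k L′ a → (∀ a → hallEntries X (L , farIdx k) a ≡ v a) →
    hadamardGraph X (L , farIdx k) (L′ , hallIdx a) ≡ hallAdj L (λ _ → false) v L′ a
  hadamardGraph-far-hall X L k L′ a entries≡ = trans (hadamardGraph-layerAdj X L (farIdx k) L′ (hallIdx a))
    (cong₂ (layerAdj (isRow L) (polarity L) (isRow L′) (polarity L′)) (farIdx≢hallIdx k a) (entries≡ a))

  halfᵇ-far : ∀ L k c → halfᵇ G partition (L , farIdx k) c ≡ ⌊ 2 * blockNbrs i L (block k) c ℕ.≟ 4 ⌋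
  halfᵇ-far L k c = cong₂ (λ a s → ⌊ 2 * a ℕ.≟ s ⌋) (nbrsIn-far L k c) (partSize-partition c)

  far-hall-switched : ∀ L k L′ a →
    toggleIf (halfᵇ G partition (L , farIdx k) (hallClass i L′ a)) (G (L , farIdx k) (L′ , hallIdx a))
    ≡ G′ (L , farIdx k) (swapLayer L′ , hallIdx a)
  far-hall-switched L k L′ a =
    trans (cong₂ toggleIf (halfᵇ-far L k (hallClass i L′ a)) (hadamardGraph-far-hall M L k L′ a (hallEntries-far L k)))
    (trans (blockAdj-switched i L (block k) L′ a)
           (sym (hadamardGraph-far-hall (switchHall i M) L k (swapLayer L′) a (hallEntries-far-switched L k))))

  gmSwitch-χ : ∀ x y → gmSwitch G partition x y ≡ G′ (χ x) (χ y)
  gmSwitch-χ (L , k) (L′ , l) with hallOrFar k | hallOrFar l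
  ... | hall a | hall b = begin
    gmSwitch G partition (L , hallIdx a) (L′ , hallIdx b)
      ≡⟨ gmSwitch-at G partition (partition-hall L a) (partition-hall L′ b) ⟩
    G (L , hallIdx a) (L′ , hallIdx b)
      ≡⟨ hadamardGraph-swapLayer M L (hallIdx a) L′ (hallIdx b) ⟩
    G (swapLayer L , hallIdx a) (swapLayer L′ , hallIdx b)
      ≡⟨ hadamardGraph-entries M (switchHall i M) (swapLayer L) (hallIdx a) (swapLayer L′) (hallIdx b)
           (sym (switchHall-hall-hall a b)) (sym (switchHall-hall-hall b a)) ⟩
    G′ (swapLayer L , hallIdx a) (swapLayer L′ , hallIdx b)
      ≡⟨ cong₂ G′ (χ-hall L a) (χ-hall L′ b) ⟨
    G′ (χ (L , hallIdx a)) (χ (L′ , hallIdx b)) ∎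
    where open ≡-Reasoning
  ... | far k′ | far l′ = begin
    gmSwitch G partition (L , farIdx k′) (L′ , farIdx l′)
      ≡⟨ gmSwitch-at G partition {L , farIdx k′} {L′ , farIdx l′} refl refl ⟩
    G (L , farIdx k′) (L′ , farIdx l′)
      ≡⟨ hadamardGraph-entries M (switchHall i M) L (farIdx k′) L′ (farIdx l′)
           (sym (switchHall-far-far k′ l′)) (sym (switchHall-far-far l′ k′)) ⟩
    G′ (L , farIdx k′) (L′ , farIdx l′) ∎
    where open ≡-Reasoning
  ... | far k′ | hall b = begin
    gmSwitch G partition (L , farIdx k′) (L′ , hallIdx b)
      ≡⟨ gmSwitch-at G partition {L , farIdx k′} refl (partition-hall L′ b) ⟩
    toggleIf (halfᵇ G partition (L , farIdx k′) (hallClass i L′ b)) (G (L , farIdx k′) (L′ , hallIdx b))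
      ≡⟨ far-hall-switched L k′ L′ b ⟩
    G′ (L , farIdx k′) (swapLayer L′ , hallIdx b)
      ≡⟨ cong (G′ (L , farIdx k′)) (χ-hall L′ b) ⟨
    G′ (L , farIdx k′) (χ (L′ , hallIdx b)) ∎
    where open ≡-Reasoning
  ... | hall a | far l′ = begin
    gmSwitch G partition (L , hallIdx a) (L′ , farIdx l′)
      ≡⟨ gmSwitch-at G partition {y = L′ , farIdx l′} (partition-hall L a) refl ⟩
    toggleIf (halfᵇ G partition (L′ , farIdx l′) (hallClass i L a)) (G (L , hallIdx a) (L′ , farIdx l′))
      ≡⟨ cong (toggleIf _) (hadamardGraph-sym M (L , hallIdx a) (L′ , farIdx l′)) ⟩
    toggleIf (halfᵇ G partition (L′ , farIdx l′) (hallClass i L a)) (G (L′ , farIdx l′) (L , hallIdx a))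
      ≡⟨ far-hall-switched L′ l′ L a ⟩
    G′ (L′ , farIdx l′) (swapLayer L , hallIdx a)
      ≡⟨ hadamardGraph-sym (switchHall i M) (L′ , farIdx l′) (swapLayer L , hallIdx a) ⟩
    G′ (swapLayer L , hallIdx a) (L′ , farIdx l′)
      ≡⟨ cong (λ x → G′ x (L′ , farIdx l′)) (χ-hall L a) ⟨
    G′ (χ (L , hallIdx a)) (L′ , farIdx l′) ∎
    where open ≡-Reasoning

  gmSwitch-isomorphic : Isomorphic (gmSwitch G partition) G′
  gmSwitch-isomorphic = mk↔ₛ′ χ χ χ-involutive χ-involutive , gmSwitch-χ

theorem3p4 : (n : ℕ) → n % 8 ≡ 4 → (H H' : Matrix n) →
  IsHadamard H → HasHallSet H → HallSwitched H H' →
  Σ ℕ λ t → Σ (Vertex n → Maybe (Fin t)) λ part →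
    IsSwitchingPartition (hadamardGraph H) part ×
    Isomorphic (gmSwitch (hadamardGraph H) part) (hadamardGraph H')
theorem3p4 0 () _ _ _ _ _
theorem3p4 1 () _ _ _ _ _
theorem3p4 2 () _ _ _ _ _
theorem3p4 3 () _ _ _ _ _
theorem3p4 (suc (suc (suc (suc n′)))) n%8≡4 H H′ _ _ (M , H~M , (H₄-block , F-block , G-block , _) , i , H′≡) =
  4 , Transport.part′ , Transport.isSwitchingPartition isSwitchingPartition ,
  Isomorphic-trans {G″ = hadamardGraph H′} (Isomorphic-sym Transport.gmSwitch-isomorphic)
    (Isomorphic-trans {G″ = hadamardGraph H′} gmSwitch-isomorphic (≗⇒Isomorphic switched≗H′))
  where
  open HallSwitching n%8≡4 M H₄-block F-block G-block i
  M≅H : Isomorphic (hadamardGraph M) (hadamardGraph H)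
  M≅H = Equivalent⇒Isomorphic H~M
  module Transport = SwitchingTransport {G = hadamardGraph M} {G′ = hadamardGraph H} (proj₁ M≅H) (proj₂ M≅H) partition
  switched≗H′ : ∀ x y → hadamardGraph (switchHall i M) x y ≡ hadamardGraph H′ x y
  switched≗H′ (L , k) (L′ , l) = hadamardGraph-entries (switchHall i M) H′ L k L′ l (sym (H′≡ k l)) (sym (H′≡ l k))
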